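{- Let $M=(E,r)$ be a $q$-matroid and let $\mathcal{Z}$ be its set of cyclic flats, viewed as a lattice with join $F\vee G=\mathrm{cl}(F+G)$, meet $F\wedge G=\mathrm{cyc}(F\cap G)$ and least element $0_{\mathcal{Z}}=\mathrm{cl}(\langle0\rangle)$. Then: (Z1) $r(0_{\mathcal{Z}})=0$; (Z2) for all $F,G\in\mathcal{Z}$ with $G<F$: $0<r(F)-r(G)<\dim F-\dim G$; (Z3) for all $F,G\in\mathcal{Z}$: $r(F)+r(G)\ge r(F\vee G)+r(F\wedge G)+\dim\big((F\cap G)/(F\wedge G)\big)$.
   Context: Let $q$ be a prime power and $E$ an $n$-dimensional $\mathbb{F}_q$-vector space. A $q$-matroid $(E,r)$ is a function $r$ from subspaces of $E$ to $\mathbb{Z}$ with (R1) $0\le r(A)\le\dim A$, (R2) $r(A)\le r(B)$ if $A\le B$, (R3) $r(A+B)+r(A\cap B)\le r(A)+r(B)$. The closure of $A$ is $\mathrm{cl}(A)=\sum x$ over all $1$-dimensional $x\le E$ with $r(A+x)=r(A)$. For $A\le E$, $\mathrm{cyc}(A)=\sum x$ over all $1$-dimensional $x\le A$ such that $r(B+x)=r(B)$ for every subspace $B\le A$ of codimension $1$ in $A$. A flat is a subspace $F$ with $r(F+x)>r(F)$ for every $1$-dimensional $x\not\le F$; a subspace $A$ is cyclic if $r(B)=r(A)$ for every $B\le A$ of codimension $1$ in $A$; a cyclic flat is a subspace that is both. -}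

module Defs where

open import Level using (0ℓ)
open import Data.Bool using (Bool; true; false; _∧_; _∨_; if_then_else_)
open import Data.Nat using (ℕ; zero; suc)
open import Data.Integer using (ℤ; +_; _-_; _+_; _<_; _≤_)
import Data.Integer.Properties as ℤP
open import Data.Vec using (Vec; []; _∷_; zipWith; replicate; map; foldr)
open import Data.List using (List; []; _∷_; concatMap)
open import Data.Bool.ListAction using (any)
import Data.List as L
open import Data.List.Membership.Propositional using (_∈_)
open import Data.Product using (Σ; ∃; ∃-syntax; _×_; _,_)
open import Relation.Nullary using (¬_; Dec; yes; no)
open import Relation.Nullary.Decidable using (⌊_⌋)
open import Relation.Binary.PropositionalEquality using (_≡_; _≢_)

-- Finiteness is
-- given by an enumeration of all elements; the number of elements
-- (q, necessarily a prime power) is not needed in the statement.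

record FiniteField : Set₁ where
  infixl 6 _+F_
  infixl 7 _*F_
  field
    Carrier : Set
    _+F_ _*F_ : Carrier → Carrier → Carrier
    0F 1F : Carrier
    -F_ : Carrier → Carrier
    _⁻¹ : Carrier → Carrier
    +-assoc : ∀ a b c → (a +F b) +F c ≡ a +F (b +F c)
    +-comm  : ∀ a b → a +F b ≡ b +F a
    +-idˡ   : ∀ a → 0F +F a ≡ a
    +-invˡ  : ∀ a → (-F a) +F a ≡ 0F
    *-assoc : ∀ a b c → (a *F b) *F c ≡ a *F (b *F c)
    *-comm  : ∀ a b → a *F b ≡ b *F a
    *-idˡ   : ∀ a → 1F *F a ≡ a
    *-invˡ  : ∀ a → a ≢ 0F → (a ⁻¹) *F a ≡ 1F
    distribˡ : ∀ a b c → a *F (b +F c) ≡ (a *F b) +F (a *F c)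
    0≢1     : 0F ≢ 1F
    _≟F_    : (a b : Carrier) → Dec (a ≡ b)
    elems   : List Carrier
    complete : ∀ a → a ∈ elems

module Space (𝔽 : FiniteField) (n : ℕ) where
  open FiniteField 𝔽

  V : Set
  V = Vec Carrier n

  0V : V
  0V = replicate n 0F

  _+V_ : V → V → V
  _+V_ = zipWith _+F_

  _·_ : Carrier → V → V
  c · v = map (c *F_) v

  -V_ : V → V
  -V_ = map -F_

  _≟V_ : ∀ {m} (u v : Vec Carrier m) → Dec (u ≡ v)
  _≟V_ = Data.Vec.Properties.≡-dec _≟F_
    where import Data.Vec.Properties

  allVecs : (m : ℕ) → List (Vec Carrier m)
  allVecs zero    = [] ∷ []
  allVecs (suc m) = concatMap (λ a → L.map (a ∷_) (allVecs m)) elems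

  Sub : Set
  Sub = V → Bool

  _∈S_ : V → Sub → Set
  v ∈S A = A v ≡ true

  _⊆_ : Sub → Sub → Set
  A ⊆ B = ∀ v → v ∈S A → v ∈S B

  _≐_ : Sub → Sub → Set
  A ≐ B = ∀ v → A v ≡ B v

  record IsSubspace (A : Sub) : Set where
    field
      zero∈ : 0V ∈S A
      +∈    : ∀ u v → u ∈S A → v ∈S A → (u +V v) ∈S A
      ·∈    : ∀ c v → v ∈S A → (c · v) ∈S A

  _⊕_ : Sub → Sub → Sub
  (A ⊕ B) v = any (λ a → A a ∧ B (v +V (-V a))) (allVecs n)

  _∩_ : Sub → Sub → Sub
  (A ∩ B) v = A v ∧ B v

  ⟨_⟩ : V → Sub
  ⟨ u ⟩ v = any (λ c → ⌊ v ≟V (c · u) ⌋) elems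

  ⟨0⟩ : Sub
  ⟨0⟩ v = ⌊ v ≟V 0V ⌋

  lincomb : ∀ {d} → Vec Carrier d → Vec V d → V
  lincomb [] [] = 0V
  lincomb (c ∷ cs) (b ∷ bs) = (c · b) +V lincomb cs bs

  data AllIn (A : Sub) : ∀ {d} → Vec V d → Set where
    []  : AllIn A []
    _∷_ : ∀ {d b} {bs : Vec V d} → b ∈S A → AllIn A bs → AllIn A (b ∷ bs)

  HasDim : Sub → ℕ → Set
  HasDim A d = Σ (Vec V d) λ bs →
      AllIn A bs
    × (∀ cs → lincomb cs bs ≡ 0V → cs ≡ replicate d 0F)
    × (∀ v → v ∈S A → ∃[ cs ] v ≡ lincomb cs bs)

  Codim1 : Sub → Sub → Set
  Codim1 B A = ∃[ d ] (HasDim A (suc d) × HasDim B d)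

  -- the subspace spanned by a (Set-valued) family of vectors:
  -- v is in  Σ_{u ∈ P} ⟨u⟩  iff v is a finite sum of elements of such ⟨u⟩
  vsum : List V → V
  vsum = L.foldr _+V_ 0V

  SpanMem : (V → Set) → V → Set
  SpanMem P v = ∃[ us ] (Data.List.Relation.Unary.All.All P us × v ≡ vsum us)
    where import Data.List.Relation.Unary.All

record QMatroid (𝔽 : FiniteField) (n : ℕ) : Set₁ where
  open Space 𝔽 n
  field
    r : Sub → ℤ
    -- r is a function of the subspace (not of its presentation)
    r-cong : ∀ A B → IsSubspace A → IsSubspace B → A ≐ B → r A ≡ r B
    R1  : ∀ A d → IsSubspace A → HasDim A d → (+ 0 ≤ r A) × (r A ≤ + d)
    R2  : ∀ A B → IsSubspace A → IsSubspace B → A ⊆ B → r A ≤ r B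
    R3  : ∀ A B → IsSubspace A → IsSubspace B →
          r (A ⊕ B) + r (A ∩ B) ≤ r A + r B

module QM {𝔽 : FiniteField} {n : ℕ} (M : QMatroid 𝔽 n) where
  open FiniteField 𝔽
  open Space 𝔽 n
  open QMatroid M

  cl : Sub → Sub
  cl A = L.foldr (λ u C → if ⌊ u ≟V 0V ⌋ then C
                          else if ⌊ r (A ⊕ ⟨ u ⟩) Data.Integer.≟ r A ⌋ then C ⊕ ⟨ u ⟩
                          else C)
                 ⟨0⟩ (allVecs n)

  CycGen : Sub → V → Set
  CycGen A u = u ≢ 0V × u ∈S A ×
    (∀ B → IsSubspace B → B ⊆ A → Codim1 B A → r (B ⊕ ⟨ u ⟩) ≡ r B)

  IsCyc : Sub → Sub → Set
  IsCyc A W = ∀ v → (v ∈S W → SpanMem (CycGen A) v) × (SpanMem (CycGen A) v → v ∈S W)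

  IsFlat : Sub → Set
  IsFlat F = ∀ u → u ≢ 0V → F u ≡ false → r F < r (F ⊕ ⟨ u ⟩)

  IsCyclic : Sub → Set
  IsCyclic A = ∀ B → IsSubspace B → B ⊆ A → Codim1 B A → r B ≡ r A

  IsCyclicFlat : Sub → Set
  IsCyclicFlat F = IsSubspace F × IsFlat F × IsCyclic F

{-# OPTIONS --safe #-}
-- (Z1) cl ⟨0⟩ is a sum of lines ⟨u⟩ with r ⟨u⟩ = 0, and submodularity keeps the rank of such a sum at 0.
-- (Z2) For v ∈ F ∖ G, flatness of G gives r G < r (G + ⟨v⟩) ≤ r F.  Extending a basis of G to one of F and
-- dropping the last vector gives a hyperplane H ⊇ G of F; r H = r F since F is cyclic, while each vector
-- added to G raises the rank by at most one, so r F - r G ≤ dim H - dim G = dim F - dim G - 1.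
-- (Z3) As r (cl A) ≤ r A, submodularity reduces (Z3) to r W + dim X - dim W ≤ r X for X = F ∩ G and
-- W = cyc X, shown for all W ⊆ Y ⊆ X by induction on dim Y: a vector y ∈ Y ∖ W is not a generator of W,
-- so some hyperplane B of X has r (B + ⟨y⟩) ≠ r B; then W ⊆ B, r B < r X, and passing from Y to Y ∩ B
-- lowers dim Y by one and, by submodularity, r Y by at least one.

module Submission where

open import Defs
open import Level using (0ℓ)
open import Function using (_∘_)
open import Function.Bundles using (Equivalence)
open import Effect.Monad using (RawMonad)
open import Algebra.Bundles using (CommutativeRing; AbelianGroup)
import Algebra.Properties.AbelianGroup as AbelianGroupProperties
import Algebra.Properties.CommutativeSemigroup as CommutativeSemigroupProperties
import Algebra.Properties.Ring as RingProperties
open import Data.Empty using (⊥-elim)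
open import Data.Product using (Σ; ∃-syntax; _×_; _,_; proj₁; proj₂)
open import Data.Bool using (Bool; true; false; _∧_; if_then_else_)
open import Data.Bool.Properties using (T-≡; ∧-conicalˡ; ∧-conicalʳ; ¬-not; not-¬)
open import Data.Bool.ListAction using (any)
open import Data.Nat as ℕ using (ℕ; zero; suc)
import Data.Nat.Properties as ℕP
open import Data.Nat.Induction using (<-rec)
open import Data.Integer as ℤ using (ℤ; +_; _-_; _+_; _<_; _≤_; 0ℤ)
import Data.Integer.Properties as ℤP
open import Data.Integer.Tactic.RingSolver using (solve-∀)
open import Data.Fin using (Fin; zero; suc)
import Data.Fin.Properties as FinP
open import Data.Vec using (Vec; []; _∷_; _∷ʳ_; initLast; zipWith; replicate; map; lookup; insertAt; removeAt; head; tail)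
open import Data.Vec.Properties
  using (zipWith-assoc; zipWith-comm; zipWith-identityˡ; zipWith-identityʳ; zipWith-inverseˡ; zipWith-inverseʳ;
         map-cong; map-∘; map-id; map-const; map-replicate; lookup-map; removeAt-insertAt; ∷ʳ-injectiveˡ)
open import Data.List using (List)
import Data.List as L
open import Data.List.Relation.Unary.All using (All; []; _∷_)
import Data.List.Relation.Unary.All.Properties as AllP
open import Data.List.Relation.Unary.Any as Any using (here)
open import Data.List.Relation.Unary.Any.Properties using (any⁺; any⁻)
open import Data.List.Membership.Propositional using (_∈_)
open import Data.List.Membership.Propositional.Properties using (∈-concatMap⁺; ∈-map⁺)
open import Relation.Nullary using (¬_; Dec; yes; no)
open import Relation.Nullary.Decidable using (⌊_⌋; ¬¬-excluded-middle; decidable-stable)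
open import Relation.Nullary.Negation using (contradiction; ¬¬-Monad)
open import Relation.Binary.PropositionalEquality

open RawMonad (¬¬-Monad {0ℓ}) using (_>>=_; pure)

module Coordinates (𝔽 : FiniteField) where
  open FiniteField 𝔽

  +-*-commutativeRing : CommutativeRing 0ℓ 0ℓ
  +-*-commutativeRing = record
    { Carrier = Carrier ; _≈_ = _≡_ ; _+_ = _+F_ ; _*_ = _*F_ ; -_ = -F_ ; 0# = 0F ; 1# = 1F
    ; isCommutativeRing = record
      { isRing = record
        { +-isAbelianGroup = record
          { isGroup = record
            { isMonoid = record
              { isSemigroup = record { isMagma = record { isEquivalence = isEquivalence ; ∙-cong = cong₂ _+F_ }
                                     ; assoc = +-assoc }
              ; identity = +-idˡ , λ a → trans (+-comm a 0F) (+-idˡ a) }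
            ; inverse = +-invˡ , λ a → trans (+-comm a (-F a)) (+-invˡ a)
            ; ⁻¹-cong = cong -F_ }
          ; comm = +-comm }
        ; *-cong = cong₂ _*F_
        ; *-assoc = *-assoc
        ; *-identity = *-idˡ , λ a → trans (*-comm a 1F) (*-idˡ a)
        ; distrib = distribˡ , λ a b c → trans (*-comm (b +F c) a)
                      (trans (distribˡ a b c) (cong₂ _+F_ (*-comm a b) (*-comm a c))) }
      ; *-comm = *-comm } }

  open CommutativeRing +-*-commutativeRing public
    using (+-identityʳ; -‿inverseʳ; distribʳ; zeroˡ; zeroʳ)
  open RingProperties (CommutativeRing.ring +-*-commutativeRing) public
    using (-1*x≈-x; -‿distribˡ-*)

  *-cancelˡ-≢0 : ∀ {a b} → a ≢ 0F → a *F b ≡ 0F → b ≡ 0F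
  *-cancelˡ-≢0 {a} {b} a≢0 ab≡0 = begin
    b                  ≡⟨ sym (*-idˡ b) ⟩
    1F *F b            ≡⟨ cong (_*F b) (sym (*-invˡ a a≢0)) ⟩
    ((a ⁻¹) *F a) *F b ≡⟨ *-assoc _ _ _ ⟩
    (a ⁻¹) *F (a *F b) ≡⟨ cong ((a ⁻¹) *F_) ab≡0 ⟩
    (a ⁻¹) *F 0F       ≡⟨ zeroʳ _ ⟩
    0F                 ∎
    where open ≡-Reasoning

  zeros : ∀ m → Vec Carrier m
  zeros m = replicate m 0F

  infixl 6 _⊞_
  infixr 7 _⊙_

  _⊞_ : ∀ {m} → Vec Carrier m → Vec Carrier m → Vec Carrier m
  _⊞_ = zipWith _+F_

  _⊙_ : ∀ {m} → Carrier → Vec Carrier m → Vec Carrier m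
  c ⊙ v = map (c *F_) v

  ⊟_ : ∀ {m} → Vec Carrier m → Vec Carrier m
  ⊟_ = map -F_

  zeros-∷ʳ : ∀ m → zeros m ∷ʳ 0F ≡ zeros (suc m)
  zeros-∷ʳ zero = refl
  zeros-∷ʳ (suc m) = cong (0F ∷_) (zeros-∷ʳ m)

  ⊞-abelianGroup : ℕ → AbelianGroup 0ℓ 0ℓ
  ⊞-abelianGroup m = record
    { Carrier = Vec Carrier m ; _≈_ = _≡_ ; _∙_ = _⊞_ ; ε = zeros m ; _⁻¹ = ⊟_
    ; isAbelianGroup = record
      { isGroup = record
        { isMonoid = record
          { isSemigroup = record { isMagma = record { isEquivalence = isEquivalence ; ∙-cong = cong₂ _⊞_ }
                                 ; assoc = zipWith-assoc +-assoc }
          ; identity = zipWith-identityˡ +-idˡ , zipWith-identityʳ +-identityʳ }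
        ; inverse = zipWith-inverseˡ +-invˡ , zipWith-inverseʳ -‿inverseʳ
        ; ⁻¹-cong = cong ⊟_ }
      ; comm = zipWith-comm +-comm } }

  module _ {m : ℕ} where
    open AbelianGroup (⊞-abelianGroup m) public
      using () renaming (assoc to ⊞-assoc; comm to ⊞-comm; identityˡ to ⊞-identityˡ; identityʳ to ⊞-identityʳ)
    open AbelianGroupProperties (⊞-abelianGroup m) public
      using () renaming (xyx⁻¹≈y to ⊞-⊟-cancelˡ; inverseˡ-unique to ⊞-inverseˡ-unique)
    open CommutativeSemigroupProperties (AbelianGroup.commutativeSemigroup (⊞-abelianGroup m)) public
      using () renaming (interchange to ⊞-interchange)

  ⊙-distribˡ : ∀ {m} c (u v : Vec Carrier m) → c ⊙ (u ⊞ v) ≡ c ⊙ u ⊞ c ⊙ v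
  ⊙-distribˡ c [] [] = refl
  ⊙-distribˡ c (a ∷ u) (b ∷ v) = cong₂ _∷_ (distribˡ c a b) (⊙-distribˡ c u v)

  ⊙-distribʳ : ∀ {m} a b (u : Vec Carrier m) → (a +F b) ⊙ u ≡ a ⊙ u ⊞ b ⊙ u
  ⊙-distribʳ a b [] = refl
  ⊙-distribʳ a b (x ∷ u) = cong₂ _∷_ (distribʳ x a b) (⊙-distribʳ a b u)

  ⊙-assoc : ∀ {m} a b (u : Vec Carrier m) → (a *F b) ⊙ u ≡ a ⊙ (b ⊙ u)
  ⊙-assoc a b u = trans (map-cong (*-assoc a b) u) (map-∘ (a *F_) (b *F_) u)

  ⊙-identityˡ : ∀ {m} (u : Vec Carrier m) → 1F ⊙ u ≡ u
  ⊙-identityˡ u = trans (map-cong *-idˡ u) (map-id u)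

  ⊙-zeroˡ : ∀ {m} (u : Vec Carrier m) → 0F ⊙ u ≡ zeros m
  ⊙-zeroˡ u = trans (map-cong zeroˡ u) (map-const u 0F)

  ⊙-zeroʳ : ∀ {m} c → c ⊙ zeros m ≡ zeros m
  ⊙-zeroʳ {m} c = trans (map-replicate (c *F_) 0F m) (cong (replicate m) (zeroʳ c))

  -1⊙u≡⊟u : ∀ {m} (u : Vec Carrier m) → (-F 1F) ⊙ u ≡ ⊟ u
  -1⊙u≡⊟u u = map-cong -1*x≈-x u

  ⊙-cancelˡ-≢0 : ∀ {m} {c} (u : Vec Carrier m) → c ≢ 0F → c ⊙ u ≡ zeros m → u ≡ zeros m
  ⊙-cancelˡ-≢0 [] c≢0 eq = refl
  ⊙-cancelˡ-≢0 (x ∷ u) c≢0 eq = cong₂ _∷_ (*-cancelˡ-≢0 c≢0 (cong head eq)) (⊙-cancelˡ-≢0 u c≢0 (cong tail eq))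

  linComb : ∀ {d m} → Vec Carrier d → Vec (Vec Carrier m) d → Vec Carrier m
  linComb [] [] = zeros _
  linComb (c ∷ cs) (b ∷ bs) = c ⊙ b ⊞ linComb cs bs

  linComb-⊞ : ∀ {d m} (a b : Vec Carrier d) (bs : Vec (Vec Carrier m) d) →
              linComb (a ⊞ b) bs ≡ linComb a bs ⊞ linComb b bs
  linComb-⊞ [] [] [] = sym (⊞-identityˡ _)
  linComb-⊞ (x ∷ a) (y ∷ b) (v ∷ bs) = begin
    (x +F y) ⊙ v ⊞ linComb (a ⊞ b) bs                  ≡⟨ cong₂ _⊞_ (⊙-distribʳ x y v) (linComb-⊞ a b bs) ⟩
    (x ⊙ v ⊞ y ⊙ v) ⊞ (linComb a bs ⊞ linComb b bs)   ≡⟨ ⊞-interchange _ _ _ _ ⟩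
    (x ⊙ v ⊞ linComb a bs) ⊞ (y ⊙ v ⊞ linComb b bs)   ∎
    where open ≡-Reasoning

  linComb-⊙ : ∀ {d m} c (a : Vec Carrier d) (bs : Vec (Vec Carrier m) d) →
              linComb (c ⊙ a) bs ≡ c ⊙ linComb a bs
  linComb-⊙ c [] [] = sym (⊙-zeroʳ c)
  linComb-⊙ c (x ∷ a) (v ∷ bs) = begin
    (c *F x) ⊙ v ⊞ linComb (c ⊙ a) bs ≡⟨ cong₂ _⊞_ (⊙-assoc c x v) (linComb-⊙ c a bs) ⟩
    c ⊙ (x ⊙ v) ⊞ c ⊙ linComb a bs    ≡⟨ sym (⊙-distribˡ c _ _) ⟩
    c ⊙ (x ⊙ v ⊞ linComb a bs)        ∎
    where open ≡-Reasoning

  linComb-zeros : ∀ {d m} (bs : Vec (Vec Carrier m) d) → linComb (zeros d) bs ≡ zeros m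
  linComb-zeros [] = refl
  linComb-zeros (v ∷ bs) = trans (cong₂ _⊞_ (⊙-zeroˡ v) (linComb-zeros bs)) (⊞-identityˡ _)

  linComb-⊟ : ∀ {d m} (a : Vec Carrier d) (bs : Vec (Vec Carrier m) d) → linComb (⊟ a) bs ≡ ⊟ linComb a bs
  linComb-⊟ a bs = begin
    linComb (⊟ a) bs            ≡⟨ cong (λ z → linComb z bs) (sym (-1⊙u≡⊟u a)) ⟩
    linComb ((-F 1F) ⊙ a) bs    ≡⟨ linComb-⊙ _ a bs ⟩
    (-F 1F) ⊙ linComb a bs      ≡⟨ -1⊙u≡⊟u _ ⟩
    ⊟ linComb a bs              ∎
    where open ≡-Reasoning

  linComb-linComb : ∀ {k d m} (x : Vec Carrier k) (A : Vec (Vec Carrier d) k) (ds : Vec (Vec Carrier m) d) →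
                    linComb x (map (λ a → linComb a ds) A) ≡ linComb (linComb x A) ds
  linComb-linComb [] [] ds = sym (linComb-zeros ds)
  linComb-linComb (c ∷ x) (a ∷ A) ds = begin
    c ⊙ linComb a ds ⊞ linComb x (map (λ a → linComb a ds) A) ≡⟨ cong₂ _⊞_ (sym (linComb-⊙ c a ds)) (linComb-linComb x A ds) ⟩
    linComb (c ⊙ a) ds ⊞ linComb (linComb x A) ds             ≡⟨ sym (linComb-⊞ (c ⊙ a) (linComb x A) ds) ⟩
    linComb (c ⊙ a ⊞ linComb x A) ds                          ∎
    where open ≡-Reasoning

  linComb-∷ʳ : ∀ {d m} (cs : Vec Carrier d) c (bs : Vec (Vec Carrier m) d) v →
               linComb (cs ∷ʳ c) (bs ∷ʳ v) ≡ linComb cs bs ⊞ c ⊙ v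
  linComb-∷ʳ [] c [] v = trans (⊞-identityʳ _) (sym (⊞-identityˡ _))
  linComb-∷ʳ (x ∷ cs) c (b ∷ bs) v = trans (cong (x ⊙ b ⊞_) (linComb-∷ʳ cs c bs v)) (sym (⊞-assoc _ _ _))

  linComb-insertAt : ∀ {k m} (y : Vec Carrier k) (p : Fin (suc k)) c (A : Vec (Vec Carrier m) (suc k)) →
                     linComb (insertAt y p c) A ≡ c ⊙ lookup A p ⊞ linComb y (removeAt A p)
  linComb-insertAt y zero c (a ∷ A) = refl
  linComb-insertAt (y₀ ∷ y) (suc p) c (a ∷ a₁ ∷ A) = begin
    y₀ ⊙ a ⊞ linComb (insertAt y p c) (a₁ ∷ A)                          ≡⟨ cong (y₀ ⊙ a ⊞_) (linComb-insertAt y p c (a₁ ∷ A)) ⟩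
    y₀ ⊙ a ⊞ (c ⊙ lookup (a₁ ∷ A) p ⊞ linComb y (removeAt (a₁ ∷ A) p)) ≡⟨ sym (⊞-assoc _ _ _) ⟩
    (y₀ ⊙ a ⊞ c ⊙ lookup (a₁ ∷ A) p) ⊞ linComb y (removeAt (a₁ ∷ A) p) ≡⟨ cong (_⊞ _) (⊞-comm _ _) ⟩
    (c ⊙ lookup (a₁ ∷ A) p ⊞ y₀ ⊙ a) ⊞ linComb y (removeAt (a₁ ∷ A) p) ≡⟨ ⊞-assoc _ _ _ ⟩
    c ⊙ lookup (a₁ ∷ A) p ⊞ (y₀ ⊙ a ⊞ linComb y (removeAt (a₁ ∷ A) p)) ∎
    where open ≡-Reasoning

  dot : ∀ {k} → Vec Carrier k → Vec Carrier k → Carrier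
  dot [] [] = 0F
  dot (c ∷ x) (g ∷ gs) = (c *F g) +F dot x gs

  linComb-∷ : ∀ {k m} (x : Vec Carrier k) (A : Vec (Vec Carrier (suc m)) k) →
              linComb x A ≡ dot x (map head A) ∷ linComb x (map tail A)
  linComb-∷ [] [] = refl
  linComb-∷ (c ∷ x) ((h ∷ t) ∷ A) rewrite linComb-∷ x A = refl

  linComb-zero-heads : ∀ {k m} (x : Vec Carrier k) (A : Vec (Vec Carrier (suc m)) k) →
                       (∀ i → head (lookup A i) ≡ 0F) → linComb x (map tail A) ≡ zeros m →
                       linComb x A ≡ zeros (suc m)
  linComb-zero-heads x A heads≡0 tails≡0 =
    trans (linComb-∷ x A) (cong₂ _∷_ (dot-zeros x (map head A) (λ i → trans (lookup-map i head A) (heads≡0 i))) tails≡0)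
    where
      dot-zeros : ∀ {k} (x hs : Vec Carrier k) → (∀ i → lookup hs i ≡ 0F) → dot x hs ≡ 0F
      dot-zeros [] [] _ = refl
      dot-zeros (c ∷ x) (h ∷ hs) hs≡0 =
        trans (cong₂ _+F_ (trans (cong (c *F_) (hs≡0 zero)) (zeroʳ c)) (dot-zeros x hs (hs≡0 ∘ suc))) (+-idˡ 0F)

  clearHead : ∀ {m} → Carrier → Vec Carrier (suc m) → Vec Carrier (suc m) → Vec Carrier (suc m)
  clearHead h a b = h ⊙ b ⊞ (-F head b) ⊙ a

  head-clearHead : ∀ {m} (a b : Vec Carrier (suc m)) → head (clearHead (head a) a b) ≡ 0F
  head-clearHead (x ∷ a) (y ∷ b) = begin
    x *F y +F (-F y) *F x   ≡⟨ cong₂ _+F_ (*-comm x y) (sym (-‿distribˡ-* y x)) ⟩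
    y *F x +F -F (y *F x)   ≡⟨ -‿inverseʳ _ ⟩
    0F                      ∎
    where open ≡-Reasoning

  linComb-clearHead : ∀ {k m} h (a : Vec Carrier (suc m)) (x : Vec Carrier k) (R : Vec (Vec Carrier (suc m)) k) →
    linComb x (map (clearHead h a) R) ≡ linComb (h ⊙ x) R ⊞ dot x (map (-F_ ∘ head) R) ⊙ a
  linComb-clearHead h a [] [] = sym (trans (cong (zeros _ ⊞_) (⊙-zeroˡ a)) (⊞-identityˡ _))
  linComb-clearHead h a (c ∷ x) (b ∷ R) = begin
    c ⊙ (h ⊙ b ⊞ g ⊙ a) ⊞ linComb x (map (clearHead h a) R)
      ≡⟨ cong₂ _⊞_ (⊙-distribˡ c _ _) (linComb-clearHead h a x R) ⟩
    (c ⊙ (h ⊙ b) ⊞ c ⊙ (g ⊙ a)) ⊞ (linComb (h ⊙ x) R ⊞ d ⊙ a)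
      ≡⟨ ⊞-interchange _ _ _ _ ⟩
    (c ⊙ (h ⊙ b) ⊞ linComb (h ⊙ x) R) ⊞ (c ⊙ (g ⊙ a) ⊞ d ⊙ a)
      ≡⟨ cong₂ (λ u w → (u ⊞ linComb (h ⊙ x) R) ⊞ (w ⊞ d ⊙ a))
               (trans (sym (⊙-assoc c h b)) (cong (_⊙ b) (*-comm c h))) (sym (⊙-assoc c g a)) ⟩
    ((h *F c) ⊙ b ⊞ linComb (h ⊙ x) R) ⊞ ((c *F g) ⊙ a ⊞ d ⊙ a)
      ≡⟨ cong (_ ⊞_) (sym (⊙-distribʳ _ _ a)) ⟩
    ((h *F c) ⊙ b ⊞ linComb (h ⊙ x) R) ⊞ ((c *F g) +F d) ⊙ a
      ∎
    where
      open ≡-Reasoning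
      g = -F head b
      d = dot x (map (-F_ ∘ head) R)

  -- Gaussian elimination on the first coordinate.
  nontrivial-relation : ∀ {m k} (A : Vec (Vec Carrier m) k) → m ℕ.< k →
                        ∃[ x ] (x ≢ zeros k × linComb x A ≡ zeros m)
  nontrivial-relation {zero} {suc k} A _ = (1F ∷ zeros k) , (λ eq → 0≢1 (sym (cong head eq))) , empty (linComb (1F ∷ zeros k) A)
    where empty : (v : Vec Carrier 0) → v ≡ []
          empty [] = refl
  nontrivial-relation {suc m} {suc k} A (ℕ.s≤s m<k) with FinP.all? (λ i → head (lookup A i) ≟F 0F)
  ... | yes heads≡0 =
    let (x , x≢0 , tails≡0) = nontrivial-relation (map tail A) (ℕP.m≤n⇒m≤1+n m<k)
    in x , x≢0 , linComb-zero-heads x A heads≡0 tails≡0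
  ... | no ¬heads≡0 =
    let (p , h≢0) = FinP.¬∀⟶∃¬ _ _ (λ i → head (lookup A i) ≟F 0F) ¬heads≡0
        a = lookup A p
        h = head a
        R = removeAt A p
        R′ = map (clearHead h a) R
        (x′ , x′≢0 , tails≡0) = nontrivial-relation (map tail R′) m<k
        c = dot x′ (map (-F_ ∘ head) R)
        heads≡0 : ∀ i → head (lookup R′ i) ≡ 0F
        heads≡0 i = trans (cong head (lookup-map i (clearHead h a) R)) (head-clearHead a (lookup R i))
        relation : linComb (insertAt (h ⊙ x′) p c) A ≡ zeros (suc m)
        relation = begin
          linComb (insertAt (h ⊙ x′) p c) A  ≡⟨ linComb-insertAt (h ⊙ x′) p c A ⟩
          c ⊙ a ⊞ linComb (h ⊙ x′) R         ≡⟨ ⊞-comm _ _ ⟩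
          linComb (h ⊙ x′) R ⊞ c ⊙ a         ≡⟨ sym (linComb-clearHead h a x′ R) ⟩
          linComb x′ R′                      ≡⟨ linComb-zero-heads x′ R′ heads≡0 tails≡0 ⟩
          zeros (suc m)                      ∎
        nonzero : insertAt (h ⊙ x′) p c ≢ zeros (suc k)
        nonzero x≡0 = x′≢0 (⊙-cancelˡ-≢0 x′ h≢0 (begin
          h ⊙ x′                                   ≡⟨ sym (removeAt-insertAt (h ⊙ x′) p c) ⟩
          removeAt (insertAt (h ⊙ x′) p c) p       ≡⟨ cong (λ z → removeAt z p) x≡0 ⟩
          removeAt (zeros (suc k)) p               ≡⟨ removeAt-zeros k p ⟩
          zeros k                                  ∎))
    in insertAt (h ⊙ x′) p c , nonzero , relation
    where
      open ≡-Reasoning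
      removeAt-zeros : ∀ k (p : Fin (suc k)) → removeAt (zeros (suc k)) p ≡ zeros k
      removeAt-zeros k zero = refl
      removeAt-zeros (suc k) (suc p) = cong (0F ∷_) (removeAt-zeros k p)

module _ {A : Set} (p : A → Bool) where

  any-true⁻ : ∀ xs → any p xs ≡ true → ∃[ x ] (p x ≡ true)
  any-true⁻ xs anyp =
    let (x , px) = Any.satisfied (any⁻ p xs (Equivalence.from T-≡ anyp)) in x , Equivalence.to T-≡ px

  any-true⁺ : ∀ {x xs} → x ∈ xs → p x ≡ true → any p xs ≡ true
  any-true⁺ x∈xs px = Equivalence.to T-≡ (any⁺ p (Any.map (λ { refl → Equivalence.from T-≡ px }) x∈xs))

⌊⌋-true⁻ : ∀ {P : Set} (p? : Dec P) → ⌊ p? ⌋ ≡ true → P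
⌊⌋-true⁻ (yes p) _ = p

⌊⌋-true⁺ : ∀ {P : Set} (p? : Dec P) → P → ⌊ p? ⌋ ≡ true
⌊⌋-true⁺ (yes _) _ = refl
⌊⌋-true⁺ (no ¬p) p = contradiction p ¬p

∧-true⁺ : ∀ {x y} → x ≡ true → y ≡ true → x ∧ y ≡ true
∧-true⁺ refl refl = refl

module Subspaces (𝔽 : FiniteField) (n : ℕ) where
  open FiniteField 𝔽
  open Space 𝔽 n
  open Coordinates 𝔽
  open IsSubspace

  allVecs-complete : ∀ m (v : Vec Carrier m) → v ∈ allVecs m
  allVecs-complete zero [] = here refl
  allVecs-complete (suc m) (a ∷ v) =
    ∈-concatMap⁺ (λ a → L.map (a ∷_) (allVecs m))
      (Any.map (λ { refl → ∈-map⁺ (a ∷_) (allVecs-complete m v) }) (complete a))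

  ∈⟨0⟩⁻ : ∀ {v} → v ∈S ⟨0⟩ → v ≡ 0V
  ∈⟨0⟩⁻ {v} = ⌊⌋-true⁻ (v ≟V 0V)

  0∈⟨0⟩ : 0V ∈S ⟨0⟩
  0∈⟨0⟩ = ⌊⌋-true⁺ (0V ≟V 0V) refl

  ∈⟨⟩⁻ : ∀ {u v} → v ∈S ⟨ u ⟩ → ∃[ c ] (v ≡ c · u)
  ∈⟨⟩⁻ {u} {v} v∈ = let (c , eq) = any-true⁻ (λ c → ⌊ v ≟V (c · u) ⌋) elems v∈ in c , ⌊⌋-true⁻ (v ≟V (c · u)) eq

  ∈⟨⟩⁺ : ∀ {u v} c → v ≡ c · u → v ∈S ⟨ u ⟩
  ∈⟨⟩⁺ {u} {v} c eq = any-true⁺ (λ c′ → ⌊ v ≟V (c′ · u) ⌋) (complete c) (⌊⌋-true⁺ (v ≟V (c · u)) eq)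

  u∈⟨u⟩ : ∀ u → u ∈S ⟨ u ⟩
  u∈⟨u⟩ u = ∈⟨⟩⁺ 1F (sym (⊙-identityˡ u))

  ∈⊕⁺ : ∀ A B {a b v} → a ∈S A → b ∈S B → v ≡ a +V b → v ∈S (A ⊕ B)
  ∈⊕⁺ A B {a} {b} a∈A b∈B refl = any-true⁺ (λ a′ → A a′ ∧ B ((a +V b) +V (-V a′))) (allVecs-complete n a)
    (∧-true⁺ a∈A (subst (_∈S B) (sym (⊞-⊟-cancelˡ a b)) b∈B))

  ∈⊕⁻ : ∀ A B {v} → v ∈S (A ⊕ B) → ∃[ a ] ∃[ b ] (a ∈S A × b ∈S B × v ≡ a +V b)
  ∈⊕⁻ A B {v} v∈ =
    let (a , ab) = any-true⁻ (λ a → A a ∧ B (v +V (-V a))) (allVecs n) v∈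
    in a , (v +V (-V a)) , ∧-conicalˡ _ _ ab , ∧-conicalʳ (A a) _ ab ,
       sym (trans (sym (⊞-assoc a v (-V a))) (⊞-⊟-cancelˡ a v))

  ∈∩⁺ : ∀ A B {v} → v ∈S A → v ∈S B → v ∈S (A ∩ B)
  ∈∩⁺ A B = ∧-true⁺

  ∈∩⁻ˡ : ∀ A B {v} → v ∈S (A ∩ B) → v ∈S A
  ∈∩⁻ˡ A B = ∧-conicalˡ _ _

  ∈∩⁻ʳ : ∀ A B {v} → v ∈S (A ∩ B) → v ∈S B
  ∈∩⁻ʳ A B {v} = ∧-conicalʳ (A v) _

  ⟨0⟩-isSubspace : IsSubspace ⟨0⟩
  ⟨0⟩-isSubspace = record
    { zero∈ = 0∈⟨0⟩
    ; +∈ = λ u v u∈ v∈ → subst (_∈S ⟨0⟩)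
             (sym (trans (cong₂ _+V_ (∈⟨0⟩⁻ u∈) (∈⟨0⟩⁻ v∈)) (⊞-identityˡ 0V))) 0∈⟨0⟩
    ; ·∈ = λ c v v∈ → subst (_∈S ⟨0⟩) (sym (trans (cong (c ·_) (∈⟨0⟩⁻ v∈)) (⊙-zeroʳ c))) 0∈⟨0⟩ }

  ⟨⟩-isSubspace : ∀ u → IsSubspace ⟨ u ⟩
  ⟨⟩-isSubspace u = record
    { zero∈ = ∈⟨⟩⁺ 0F (sym (⊙-zeroˡ u))
    ; +∈ = λ v w v∈ w∈ → let (a , v≡) = ∈⟨⟩⁻ v∈ ; (b , w≡) = ∈⟨⟩⁻ w∈ in
             ∈⟨⟩⁺ (a +F b) (trans (cong₂ _+V_ v≡ w≡) (sym (⊙-distribʳ a b u)))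
    ; ·∈ = λ c v v∈ → let (a , v≡) = ∈⟨⟩⁻ v∈ in
             ∈⟨⟩⁺ (c *F a) (trans (cong (c ·_) v≡) (sym (⊙-assoc c a u))) }

  ∩-isSubspace : ∀ {A B} → IsSubspace A → IsSubspace B → IsSubspace (A ∩ B)
  ∩-isSubspace {A} {B} sA sB = record
    { zero∈ = ∈∩⁺ A B (zero∈ sA) (zero∈ sB)
    ; +∈ = λ u v u∈ v∈ → ∈∩⁺ A B (+∈ sA u v (∈∩⁻ˡ A B u∈) (∈∩⁻ˡ A B v∈)) (+∈ sB u v (∈∩⁻ʳ A B u∈) (∈∩⁻ʳ A B v∈))
    ; ·∈ = λ c v v∈ → ∈∩⁺ A B (·∈ sA c v (∈∩⁻ˡ A B v∈)) (·∈ sB c v (∈∩⁻ʳ A B v∈)) }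

  ⊕-isSubspace : ∀ {A B} → IsSubspace A → IsSubspace B → IsSubspace (A ⊕ B)
  ⊕-isSubspace {A} {B} sA sB = record
    { zero∈ = ∈⊕⁺ A B (zero∈ sA) (zero∈ sB) (sym (⊞-identityˡ 0V))
    ; +∈ = λ u v u∈ v∈ → let (a₁ , b₁ , a₁∈ , b₁∈ , u≡) = ∈⊕⁻ A B u∈ ; (a₂ , b₂ , a₂∈ , b₂∈ , v≡) = ∈⊕⁻ A B v∈ in
             ∈⊕⁺ A B (+∈ sA a₁ a₂ a₁∈ a₂∈) (+∈ sB b₁ b₂ b₁∈ b₂∈) (trans (cong₂ _+V_ u≡ v≡) (⊞-interchange a₁ b₁ a₂ b₂))
    ; ·∈ = λ c v v∈ → let (a , b , a∈ , b∈ , v≡) = ∈⊕⁻ A B v∈ in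
             ∈⊕⁺ A B (·∈ sA c a a∈) (·∈ sB c b b∈) (trans (cong (c ·_) v≡) (⊙-distribˡ c a b)) }

  ⊆-refl : ∀ {A} → A ⊆ A
  ⊆-refl v v∈ = v∈

  ⊆-trans : ∀ {A B C} → A ⊆ B → B ⊆ C → A ⊆ C
  ⊆-trans A⊆B B⊆C v v∈ = B⊆C v (A⊆B v v∈)

  A⊆A⊕B : ∀ {A B} → IsSubspace B → A ⊆ (A ⊕ B)
  A⊆A⊕B {A} {B} sB v v∈ = ∈⊕⁺ A B v∈ (zero∈ sB) (sym (⊞-identityʳ v))

  B⊆A⊕B : ∀ {A B} → IsSubspace A → B ⊆ (A ⊕ B)
  B⊆A⊕B {A} {B} sA v v∈ = ∈⊕⁺ A B (zero∈ sA) v∈ (sym (⊞-identityˡ v))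

  ⊕-mono : ∀ {A A′ B B′} → A ⊆ A′ → B ⊆ B′ → (A ⊕ B) ⊆ (A′ ⊕ B′)
  ⊕-mono {A} {A′} {B} {B′} A⊆ B⊆ v v∈ = let (a , b , a∈ , b∈ , v≡) = ∈⊕⁻ A B v∈ in ∈⊕⁺ A′ B′ (A⊆ a a∈) (B⊆ b b∈) v≡

  ⊕-least : ∀ {A B C} → IsSubspace C → A ⊆ C → B ⊆ C → (A ⊕ B) ⊆ C
  ⊕-least {A} {B} {C} sC A⊆ B⊆ v v∈ =
    let (a , b , a∈ , b∈ , v≡) = ∈⊕⁻ A B v∈ in subst (_∈S C) (sym v≡) (+∈ sC a b (A⊆ a a∈) (B⊆ b b∈))

  ⟨⟩-least : ∀ {A u} → IsSubspace A → u ∈S A → ⟨ u ⟩ ⊆ A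
  ⟨⟩-least {A} sA u∈ v v∈ = let (c , v≡) = ∈⟨⟩⁻ v∈ in subst (_∈S A) (sym v≡) (·∈ sA c _ u∈)

  ⟨0⟩-least : ∀ {A} → IsSubspace A → ⟨0⟩ ⊆ A
  ⟨0⟩-least {A} sA v v∈ = subst (_∈S A) (sym (∈⟨0⟩⁻ v∈)) (zero∈ sA)

  -∈ : ∀ {A} → IsSubspace A → ∀ {v} → v ∈S A → (-V v) ∈S A
  -∈ {A} sA {v} v∈ = subst (_∈S A) (-1⊙u≡⊟u v) (·∈ sA (-F 1F) v v∈)

  lincomb≡linComb : ∀ {d} (cs : Vec Carrier d) (bs : Vec V d) → lincomb cs bs ≡ linComb cs bs
  lincomb≡linComb [] [] = refl
  lincomb≡linComb (c ∷ cs) (b ∷ bs) = cong ((c · b) +V_) (lincomb≡linComb cs bs)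

  AllIn-mono : ∀ {A B d} {bs : Vec V d} → A ⊆ B → AllIn A bs → AllIn B bs
  AllIn-mono A⊆B [] = []
  AllIn-mono A⊆B (b∈ ∷ bs∈) = A⊆B _ b∈ ∷ AllIn-mono A⊆B bs∈

  AllIn-∷ʳ : ∀ {A d} {bs : Vec V d} {v} → AllIn A bs → v ∈S A → AllIn A (bs ∷ʳ v)
  AllIn-∷ʳ [] v∈ = v∈ ∷ []
  AllIn-∷ʳ (b∈ ∷ bs∈) v∈ = b∈ ∷ AllIn-∷ʳ bs∈ v∈

  AllIn-init : ∀ {A d} (bs : Vec V d) {v} → AllIn A (bs ∷ʳ v) → AllIn A bs
  AllIn-init [] _ = []
  AllIn-init (b ∷ bs) (b∈ ∷ bs∈) = b∈ ∷ AllIn-init bs bs∈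

  linComb∈ : ∀ {A d} → IsSubspace A → {bs : Vec V d} → AllIn A bs → ∀ cs → linComb cs bs ∈S A
  linComb∈ sA [] [] = zero∈ sA
  linComb∈ sA (b∈ ∷ bs∈) (c ∷ cs) = +∈ sA _ _ (·∈ sA c _ b∈) (linComb∈ sA bs∈ cs)

  span : ∀ {d} → Vec V d → Sub
  span {d} bs v = any (λ cs → ⌊ v ≟V linComb cs bs ⌋) (allVecs d)

  ∈span⁻ : ∀ {d} {bs : Vec V d} {v} → v ∈S span bs → ∃[ cs ] (v ≡ linComb cs bs)
  ∈span⁻ {d} {bs} {v} v∈ =
    let (cs , eq) = any-true⁻ (λ cs → ⌊ v ≟V linComb cs bs ⌋) (allVecs d) v∈ in cs , ⌊⌋-true⁻ (v ≟V linComb cs bs) eq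

  ∈span⁺ : ∀ {d} {bs : Vec V d} {v} cs → v ≡ linComb cs bs → v ∈S span bs
  ∈span⁺ {d} {bs} {v} cs eq =
    any-true⁺ (λ cs → ⌊ v ≟V linComb cs bs ⌋) (allVecs-complete d cs) (⌊⌋-true⁺ (v ≟V linComb cs bs) eq)

  span-isSubspace : ∀ {d} (bs : Vec V d) → IsSubspace (span bs)
  span-isSubspace bs = record
    { zero∈ = ∈span⁺ {bs = bs} (zeros _) (sym (linComb-zeros bs))
    ; +∈ = λ u v u∈ v∈ → let (a , u≡) = ∈span⁻ u∈ ; (b , v≡) = ∈span⁻ v∈ in
             ∈span⁺ (a ⊞ b) (trans (cong₂ _+V_ u≡ v≡) (sym (linComb-⊞ a b bs)))
    ; ·∈ = λ c v v∈ → let (a , v≡) = ∈span⁻ v∈ in ∈span⁺ (c ⊙ a) (trans (cong (c ·_) v≡) (sym (linComb-⊙ c a bs))) }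

  span-least : ∀ {A d} {bs : Vec V d} → IsSubspace A → AllIn A bs → span bs ⊆ A
  span-least {A} sA bs∈ v v∈ = let (cs , v≡) = ∈span⁻ v∈ in subst (_∈S A) (sym v≡) (linComb∈ sA bs∈ cs)

  AllIn-span : ∀ {d} (bs : Vec V d) → AllIn (span bs) bs
  AllIn-span [] = []
  AllIn-span (b ∷ bs) = b∈ ∷ AllIn-mono span-bs⊆ (AllIn-span bs)
    where
      b∈ : b ∈S span (b ∷ bs)
      b∈ = ∈span⁺ (1F ∷ zeros _) (sym (trans (cong₂ _+V_ (⊙-identityˡ b) (linComb-zeros bs)) (⊞-identityʳ b)))
      span-bs⊆ : span bs ⊆ span (b ∷ bs)
      span-bs⊆ v v∈ = let (cs , v≡) = ∈span⁻ v∈ in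
        ∈span⁺ (0F ∷ cs) (trans v≡ (sym (trans (cong (_+V linComb cs bs) (⊙-zeroˡ b)) (⊞-identityˡ _))))

  span-∷ʳ : ∀ {d} (bs : Vec V d) v → span (bs ∷ʳ v) ⊆ (span bs ⊕ ⟨ v ⟩)
  span-∷ʳ bs v w w∈ with ∈span⁻ w∈
  ... | x , w≡ with initLast x
  ...   | cs , c , refl = ∈⊕⁺ (span bs) ⟨ v ⟩ (∈span⁺ cs refl) (∈⟨⟩⁺ c refl) (trans w≡ (linComb-∷ʳ cs c bs v))

  Independent : ∀ {d} → Vec V d → Set
  Independent {d} bs = ∀ cs → linComb cs bs ≡ 0V → cs ≡ zeros d

  Basis : ∀ {d} → Sub → Vec V d → Set
  Basis S bs = AllIn S bs × Independent bs × S ⊆ span bs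

  HasDim⇒Basis : ∀ {S d} → HasDim S d → Σ (Vec V d) (Basis S)
  HasDim⇒Basis (bs , bs∈ , indep , spans) = bs , bs∈ ,
    (λ cs eq → indep cs (trans (lincomb≡linComb cs bs) eq)) ,
    (λ v v∈ → let (cs , v≡) = spans v v∈ in ∈span⁺ cs (trans v≡ (lincomb≡linComb cs bs)))

  Basis⇒HasDim : ∀ {S d} (bs : Vec V d) → Basis S bs → HasDim S d
  Basis⇒HasDim bs (bs∈ , indep , spans) = bs , bs∈ ,
    (λ cs eq → indep cs (trans (sym (lincomb≡linComb cs bs)) eq)) ,
    (λ v v∈ → let (cs , v≡) = ∈span⁻ (spans v v∈) in cs , trans v≡ (sym (lincomb≡linComb cs bs)))

  ⊈⇒∃∉ : ∀ {A B} → ¬ (A ⊆ B) → ¬ ¬ (∃[ v ] (v ∈S A × B v ≡ false))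
  ⊈⇒∃∉ {A} {B} A⊈B ∄ = A⊈B λ v v∈A → decidable-stable (B v Data.Bool.≟ true) (λ v∉B → ∄ (v , v∈A , ¬-not v∉B))

  steinitz : ∀ {k m} (bs : Vec V k) (ds : Vec V m) → Independent bs → AllIn (span ds) bs → k ℕ.≤ m
  steinitz {k} {m} bs ds indep bs∈ with k ℕ.≤? m
  ... | yes k≤m = k≤m
  ... | no k≰m =
    let (A , bs≡) = coordinates bs∈
        (x , x≢0 , rel) = nontrivial-relation A (ℕP.≰⇒> k≰m)
    in contradiction (indep x (begin
         linComb x bs                              ≡⟨ cong (linComb x) bs≡ ⟩
         linComb x (map (λ a → linComb a ds) A)    ≡⟨ linComb-linComb x A ds ⟩
         linComb (linComb x A) ds                  ≡⟨ cong (λ z → linComb z ds) rel ⟩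
         linComb (zeros m) ds                      ≡⟨ linComb-zeros ds ⟩
         0V                                        ∎)) x≢0
    where
      open ≡-Reasoning
      coordinates : ∀ {k} {bs : Vec V k} → AllIn (span ds) bs → ∃[ A ] (bs ≡ map (λ a → linComb a ds) A)
      coordinates [] = [] , refl
      coordinates (b∈ ∷ bs∈) = let (a , b≡) = ∈span⁻ b∈ ; (A , bs≡) = coordinates bs∈ in (a ∷ A) , cong₂ _∷_ b≡ bs≡

  independent-∷ʳ : ∀ {d} (bs : Vec V d) v → Independent bs → span bs v ≡ false → Independent (bs ∷ʳ v)
  independent-∷ʳ {d} bs v indep v∉ x rel with initLast x
  ... | cs , c , refl with c ≟F 0F
  ...   | yes refl = trans (cong (_∷ʳ 0F) (indep cs cs-rel)) (zeros-∷ʳ d)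
    where
      cs-rel : linComb cs bs ≡ 0V
      cs-rel = begin
        linComb cs bs                              ≡⟨ sym (⊞-identityʳ _) ⟩
        linComb cs bs ⊞ zeros n                    ≡⟨ cong (linComb cs bs ⊞_) (sym (⊙-zeroˡ v)) ⟩
        linComb cs bs ⊞ 0F ⊙ v                     ≡⟨ sym (linComb-∷ʳ cs 0F bs v) ⟩
        linComb (cs ∷ʳ 0F) (bs ∷ʳ v)               ≡⟨ rel ⟩
        0V                                         ∎
        where open ≡-Reasoning
  ...   | no c≢0 = contradiction (∈span⁺ {bs = bs} ((c ⁻¹) ⊙ ⊟ cs) v≡) (λ v∈ → not-¬ v∈ v∉)
    where
      c⊙v≡ : c ⊙ v ≡ ⊟ linComb cs bs
      c⊙v≡ = ⊞-inverseˡ-unique (c ⊙ v) (linComb cs bs)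
               (trans (⊞-comm _ _) (trans (sym (linComb-∷ʳ cs c bs v)) rel))
      v≡ : v ≡ linComb ((c ⁻¹) ⊙ ⊟ cs) bs
      v≡ = begin
        v                            ≡⟨ sym (⊙-identityˡ v) ⟩
        1F ⊙ v                       ≡⟨ cong (_⊙ v) (sym (*-invˡ c c≢0)) ⟩
        ((c ⁻¹) *F c) ⊙ v            ≡⟨ ⊙-assoc _ _ v ⟩
        (c ⁻¹) ⊙ (c ⊙ v)             ≡⟨ cong ((c ⁻¹) ⊙_) c⊙v≡ ⟩
        (c ⁻¹) ⊙ ⊟ linComb cs bs     ≡⟨ cong ((c ⁻¹) ⊙_) (sym (linComb-⊟ cs bs)) ⟩
        (c ⁻¹) ⊙ linComb (⊟ cs) bs   ≡⟨ sym (linComb-⊙ (c ⁻¹) (⊟ cs) bs) ⟩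
        linComb ((c ⁻¹) ⊙ ⊟ cs) bs   ∎
        where open ≡-Reasoning

  independent-init : ∀ {d} (bs : Vec V d) v → Independent (bs ∷ʳ v) → Independent bs
  independent-init {d} bs v indep cs rel = ∷ʳ-injectiveˡ cs (zeros d) (begin
    cs ∷ʳ 0F      ≡⟨ indep (cs ∷ʳ 0F) (begin
        linComb (cs ∷ʳ 0F) (bs ∷ʳ v)  ≡⟨ linComb-∷ʳ cs 0F bs v ⟩
        linComb cs bs ⊞ 0F ⊙ v        ≡⟨ cong₂ _⊞_ rel (⊙-zeroˡ v) ⟩
        0V ⊞ 0V                       ≡⟨ ⊞-identityˡ _ ⟩
        0V                            ∎) ⟩
    zeros (suc d) ≡⟨ sym (zeros-∷ʳ d) ⟩
    zeros d ∷ʳ 0F ∎)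
    where open ≡-Reasoning

  data Extends {a} (gs : Vec V a) : ∀ {ℓ} → Vec V ℓ → Set where
    start : Extends gs gs
    snoc : ∀ {ℓ} {T : Vec V ℓ} v → Extends gs T → Extends gs (T ∷ʳ v)

  -- The loop terminates because an independent list in S ⊆ span ds has at most m vectors.
  extend-to-basis : ∀ {S} → IsSubspace S → ∀ {m} (ds : Vec V m) → S ⊆ span ds →
                    ∀ {a} (gs : Vec V a) → AllIn S gs → Independent gs →
                    ¬ ¬ (∃[ ℓ ] Σ (Vec V ℓ) λ T → Extends gs T × Basis S T)
  extend-to-basis {S} sS {m} ds S⊆ {a} gs gs∈ gs-indep = loop (suc m) gs (ℕP.m≤n+m (suc m) a) start gs∈ gs-indep
    where
      loop : ∀ fuel {ℓ} (T : Vec V ℓ) → suc m ℕ.≤ ℓ ℕ.+ fuel → Extends gs T → AllIn S T → Independent T →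
             ¬ ¬ (∃[ ℓ ] Σ (Vec V ℓ) λ T → Extends gs T × Basis S T)
      loop zero {ℓ} T bound _ T∈ T-indep =
        contradiction (steinitz T ds T-indep (AllIn-mono S⊆ T∈)) (ℕP.<⇒≱ (subst (suc m ℕ.≤_) (ℕP.+-identityʳ ℓ) bound))
      loop (suc fuel) {ℓ} T bound ext T∈ T-indep = ¬¬-excluded-middle >>= λ
        { (yes S⊆T) → pure (ℓ , T , ext , T∈ , T-indep , S⊆T)
        ; (no S⊈T) → ⊈⇒∃∉ S⊈T >>= λ (v , v∈ , v∉) →
            loop fuel (T ∷ʳ v) (subst (suc m ℕ.≤_) (ℕP.+-suc ℓ fuel) bound)
                 (snoc v ext) (AllIn-∷ʳ T∈ v∈) (independent-∷ʳ T v T-indep v∉) }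

  basis-exists : ∀ {S} → IsSubspace S → ∀ {m} (ds : Vec V m) → S ⊆ span ds →
                 ¬ ¬ (∃[ ℓ ] Σ (Vec V ℓ) (Basis S))
  basis-exists sS ds S⊆ = extend-to-basis sS ds S⊆ [] [] (λ { [] _ → refl }) >>= λ (ℓ , T , _ , T-basis) → pure (ℓ , T , T-basis)

  -- A basis of B followed by z and x would be an independent list of dim X + 1 vectors in X.
  codim1-⊕⟨⟩ : ∀ {X B} → IsSubspace B → B ⊆ X → Codim1 B X → ∀ {z} → z ∈S X → B z ≡ false → X ⊆ (B ⊕ ⟨ z ⟩)
  codim1-⊕⟨⟩ {X} {B} sB B⊆X (d , dimX , dimB) {z} z∈X z∉B x x∈X with (B ⊕ ⟨ z ⟩) x in x∈?
  ... | true = refl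
  ... | false = ⊥-elim (ℕP.<-irrefl refl (steinitz ((bs ∷ʳ z) ∷ʳ x) xs bs-z-x-indep
                  (AllIn-mono xs-spans (AllIn-∷ʳ (AllIn-∷ʳ (AllIn-mono B⊆X bs∈) z∈X) x∈X))))
    where
      bs = proj₁ (HasDim⇒Basis dimB)
      bs∈ = proj₁ (proj₂ (HasDim⇒Basis dimB))
      bs-indep = proj₁ (proj₂ (proj₂ (HasDim⇒Basis dimB)))
      xs = proj₁ (HasDim⇒Basis dimX)
      xs-spans = proj₂ (proj₂ (proj₂ (HasDim⇒Basis dimX)))
      z∉span : span bs z ≡ false
      z∉span = ¬-not (λ z∈ → not-¬ (span-least sB bs∈ z z∈) z∉B)
      x∉span : span (bs ∷ʳ z) x ≡ false
      x∉span = ¬-not (λ x∈ → not-¬ (⊕-mono {A = span bs} {B = ⟨ z ⟩} (span-least sB bs∈) ⊆-refl x (span-∷ʳ bs z x x∈)) x∈?)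
      bs-z-x-indep = independent-∷ʳ (bs ∷ʳ z) x (independent-∷ʳ bs z bs-indep z∉span) x∉span

  dim-∩-hyperplane : ∀ {Y B y} → IsSubspace Y → IsSubspace B → Y ⊆ (B ⊕ ⟨ y ⟩) → y ∈S Y → B y ≡ false →
                     ∀ {e e′} {bs : Vec V e} {bs′ : Vec V e′} → Basis Y bs → Basis (Y ∩ B) bs′ → e ≡ suc e′
  dim-∩-hyperplane {Y} {B} {y} sY sB Y⊆ y∈Y y∉B {bs = bs} {bs′} (bs∈ , bs-indep , Y⊆span) (bs′∈ , bs′-indep , Y∩B⊆span) =
    ℕP.≤-antisym (steinitz bs (bs′ ∷ʳ y) bs-indep (AllIn-mono Y⊆span′ bs∈))
                 (steinitz (bs′ ∷ʳ y) bs (independent-∷ʳ bs′ y bs′-indep y∉span) (AllIn-mono Y⊆span (AllIn-∷ʳ bs′⊆Y y∈Y)))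
    where
      bs′⊆Y : AllIn Y bs′
      bs′⊆Y = AllIn-mono (λ v → ∈∩⁻ˡ Y B) bs′∈
      y∉span : span bs′ y ≡ false
      y∉span = ¬-not (λ y∈ → not-¬ (∈∩⁻ʳ Y B (span-least (∩-isSubspace sY sB) bs′∈ y y∈)) y∉B)
      Y⊆span′ : Y ⊆ span (bs′ ∷ʳ y)
      Y⊆span′ z z∈Y =
        let (b , t , b∈B , t∈ , z≡) = ∈⊕⁻ B ⟨ y ⟩ (Y⊆ z z∈Y)
            (c , t≡) = ∈⟨⟩⁻ {y} t∈
            b≡ : b ≡ z +V (-V t)
            b≡ = trans (sym (⊞-⊟-cancelˡ t b)) (cong (_+V (-V t)) (trans (⊞-comm t b) (sym z≡)))
            b∈Y : b ∈S Y
            b∈Y = subst (_∈S Y) (sym b≡) (+∈ sY z (-V t) z∈Y (-∈ sY (⟨⟩-least sY y∈Y t t∈)))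
            (cs , b≡cs) = ∈span⁻ (Y∩B⊆span b (∈∩⁺ Y B b∈Y b∈B))
        in ∈span⁺ (cs ∷ʳ c) (trans z≡ (trans (cong₂ _+V_ b≡cs t≡) (sym (linComb-∷ʳ cs c bs′ y))))

≤-from-difference : ∀ {a b c d : ℤ} → b - a ≡ d - c → c ≤ d → a ≤ b
≤-from-difference eq c≤d = ℤP.0≤i-j⇒j≤i (subst (0ℤ ≤_) (sym eq) (ℤP.i≤j⇒0≤j-i c≤d))

i<j⇒0<j-i : ∀ {i j} → i < j → + 0 < j - i
i<j⇒0<j-i {i} {j} i<j = ℤP.suc[i]≤j⇒i<j (≤-from-difference (rearrange i j) (ℤP.i<j⇒suc[i]≤j i<j))
  where
    rearrange : ∀ i j → (j - i) - (+ 1 + + 0) ≡ j - (+ 1 + i)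
    rearrange = solve-∀

module Rank {𝔽 : FiniteField} {n : ℕ} (M : QMatroid 𝔽 n) where
  open FiniteField 𝔽
  open Space 𝔽 n
  open QMatroid M
  open QM M
  open Coordinates 𝔽
  open Subspaces 𝔽 n
  open IsSubspace

  r-mutual-⊆ : ∀ {A B} → IsSubspace A → IsSubspace B → A ⊆ B → B ⊆ A → r A ≡ r B
  r-mutual-⊆ {A} {B} sA sB A⊆B B⊆A = ℤP.≤-antisym (R2 A B sA sB A⊆B) (R2 B A sB sA B⊆A)

  r⟨0⟩≡0 : r ⟨0⟩ ≡ + 0
  r⟨0⟩≡0 = let (0≤r , r≤0) = R1 ⟨0⟩ 0 ⟨0⟩-isSubspace dim⟨0⟩ in ℤP.≤-antisym r≤0 0≤r
    where
      dim⟨0⟩ : HasDim ⟨0⟩ 0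
      dim⟨0⟩ = [] , [] , (λ { [] _ → refl }) , (λ v v∈ → [] , ∈⟨0⟩⁻ v∈)

  r-nonneg : ∀ {A} → IsSubspace A → + 0 ≤ r A
  r-nonneg {A} sA = subst (_≤ r A) r⟨0⟩≡0 (R2 ⟨0⟩ A ⟨0⟩-isSubspace sA (⟨0⟩-least sA))

  r⟨u⟩≤1 : ∀ u → u ≢ 0V → r ⟨ u ⟩ ≤ + 1
  r⟨u⟩≤1 u u≢0 = proj₂ (R1 ⟨ u ⟩ 1 (⟨⟩-isSubspace u) (Basis⇒HasDim (u ∷ []) (u∈⟨u⟩ u ∷ [] , indep , spans)))
    where
      indep : Independent (u ∷ [])
      indep (c ∷ []) rel with c ≟F 0F
      ... | yes c≡0 = cong (_∷ []) c≡0
      ... | no c≢0 = contradiction (⊙-cancelˡ-≢0 u c≢0 (trans (sym (⊞-identityʳ _)) rel)) u≢0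
      spans : ⟨ u ⟩ ⊆ span (u ∷ [])
      spans v v∈ = let (c , v≡) = ∈⟨⟩⁻ {u} v∈ in ∈span⁺ (c ∷ []) (trans v≡ (sym (⊞-identityʳ _)))

  r-⊕⟨⟩≤ : ∀ {A} → IsSubspace A → ∀ z → r (A ⊕ ⟨ z ⟩) ≤ r A + + 1
  r-⊕⟨⟩≤ {A} sA z with z ≟V 0V
  ... | yes refl = ℤP.≤-trans (R2 (A ⊕ ⟨ z ⟩) A (⊕-isSubspace sA (⟨⟩-isSubspace z)) sA
                                  (⊕-least sA ⊆-refl (⟨⟩-least sA (zero∈ sA))))
                              (ℤP.i≤i+j (r A) (+ 1))
  ... | no z≢0 = combine {a = r A} (R3 A ⟨ z ⟩ sA (⟨⟩-isSubspace z)) (r-nonneg (∩-isSubspace sA (⟨⟩-isSubspace z))) (r⟨u⟩≤1 z z≢0)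
    where
      combine : ∀ {s i a l} → s + i ≤ a + l → + 0 ≤ i → l ≤ + 1 → s ≤ a + + 1
      combine {s} {i} {a} {l} h₁ h₂ h₃ = ≤-from-difference (rearrange s i a l) (ℤP.+-mono-≤ h₁ (ℤP.+-mono-≤ h₂ h₃))
        where
          rearrange : ∀ s i a l → (a + + 1) - s ≡ ((a + l) + (i + + 1)) - ((s + i) + (+ 0 + l))
          rearrange = solve-∀

  cl-induction : (P : Sub → Set) (A : Sub) → P ⟨0⟩ →
                 (∀ u C → P C → u ≢ 0V → r (A ⊕ ⟨ u ⟩) ≡ r A → P (C ⊕ ⟨ u ⟩)) → P (cl A)
  cl-induction P A P⟨0⟩ P-step = go (allVecs n)
    where
      go : ∀ us → P (L.foldr (λ u C → if ⌊ u ≟V 0V ⌋ then C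
                                      else if ⌊ r (A ⊕ ⟨ u ⟩) ℤ.≟ r A ⌋ then C ⊕ ⟨ u ⟩
                                      else C) ⟨0⟩ us)
      go L.[] = P⟨0⟩
      go (u L.∷ us) with u ≟V 0V
      ... | yes _ = go us
      ... | no u≢0 with r (A ⊕ ⟨ u ⟩) ℤ.≟ r A
      ...   | yes r≡ = P-step u _ (go us) u≢0 r≡
      ...   | no _ = go us

  r-cl⟨0⟩≡0 : r (cl ⟨0⟩) ≡ + 0
  r-cl⟨0⟩≡0 = let (s , r≤0) = invariant in ℤP.≤-antisym r≤0 (r-nonneg s)
    where
      combine : ∀ {s i c l} → s + i ≤ c + l → + 0 ≤ i → c + l ≤ + 0 → s ≤ + 0
      combine {s} {i} {c} {l} h₁ h₂ h₃ = ≤-from-difference (rearrange s i c l) (ℤP.+-mono-≤ h₁ (ℤP.+-mono-≤ h₂ h₃))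
        where
          rearrange : ∀ s i c l → + 0 - s ≡ ((c + l) + (i + + 0)) - ((s + i) + (+ 0 + (c + l)))
          rearrange = solve-∀
      invariant : IsSubspace (cl ⟨0⟩) × r (cl ⟨0⟩) ≤ + 0
      invariant = cl-induction (λ C → IsSubspace C × r C ≤ + 0) ⟨0⟩ (⟨0⟩-isSubspace , ℤP.≤-reflexive r⟨0⟩≡0)
        λ u C (sC , rC≤0) u≢0 r≡ →
          let r⟨u⟩≤0 : r ⟨ u ⟩ ≤ + 0
              r⟨u⟩≤0 = ℤP.≤-trans (R2 ⟨ u ⟩ (⟨0⟩ ⊕ ⟨ u ⟩) (⟨⟩-isSubspace u) (⊕-isSubspace ⟨0⟩-isSubspace (⟨⟩-isSubspace u))
                                      (B⊆A⊕B ⟨0⟩-isSubspace))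
                                  (ℤP.≤-reflexive (trans r≡ r⟨0⟩≡0))
          in ⊕-isSubspace sC (⟨⟩-isSubspace u) ,
             combine {c = r C} (R3 C ⟨ u ⟩ sC (⟨⟩-isSubspace u)) (r-nonneg (∩-isSubspace sC (⟨⟩-isSubspace u)))
                     (ℤP.+-mono-≤ rC≤0 r⟨u⟩≤0)

  r-cl≤ : ∀ {X} → IsSubspace X → r (cl X) ≤ r X
  r-cl≤ {X} sX = let (sC , r≤) = invariant in
    ℤP.≤-trans (R2 (cl X) (X ⊕ cl X) sC (⊕-isSubspace sX sC) (B⊆A⊕B sX)) r≤
    where
      combine : ∀ {s x i d y} → s + i ≤ d + y → x ≤ i → d ≤ x → y ≤ x → s ≤ x
      combine {s} {x} {i} {d} {y} h₁ h₂ h₃ h₄ =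
        ≤-from-difference (rearrange s x i d y) (ℤP.+-mono-≤ (ℤP.+-mono-≤ h₃ h₄) (ℤP.+-mono-≤ h₁ h₂))
        where
          rearrange : ∀ s x i d y → x - s ≡ ((x + x) + ((d + y) + i)) - ((d + y) + ((s + i) + x))
          rearrange = solve-∀
      invariant : IsSubspace (cl X) × r (X ⊕ cl X) ≤ r X
      invariant = cl-induction (λ C → IsSubspace C × r (X ⊕ C) ≤ r X) X
        (⟨0⟩-isSubspace , R2 (X ⊕ ⟨0⟩) X (⊕-isSubspace sX ⟨0⟩-isSubspace) sX (⊕-least sX ⊆-refl (⟨0⟩-least sX)))
        λ u C (sC , rXC≤) u≢0 r≡ →
          let D = X ⊕ C
              sD = ⊕-isSubspace sX sC
              sXu = ⊕-isSubspace sX (⟨⟩-isSubspace u)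
              sDXu = ⊕-isSubspace sD sXu
              X⊕C⊕u⊆ : (X ⊕ (C ⊕ ⟨ u ⟩)) ⊆ (D ⊕ (X ⊕ ⟨ u ⟩))
              X⊕C⊕u⊆ = ⊕-least {A = X} sDXu (⊆-trans (A⊆A⊕B sC) (A⊆A⊕B sXu))
                         (⊕-least {A = C} {B = ⟨ u ⟩} sDXu (⊆-trans (B⊆A⊕B sX) (A⊆A⊕B sXu)) (⊆-trans (B⊆A⊕B sX) (B⊆A⊕B sD)))
              X⊆D∩ : X ⊆ (D ∩ (X ⊕ ⟨ u ⟩))
              X⊆D∩ v v∈ = ∈∩⁺ D (X ⊕ ⟨ u ⟩) (A⊆A⊕B sC v v∈) (A⊆A⊕B (⟨⟩-isSubspace u) v v∈)
          in ⊕-isSubspace sC (⟨⟩-isSubspace u) ,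
             ℤP.≤-trans (R2 (X ⊕ (C ⊕ ⟨ u ⟩)) (D ⊕ (X ⊕ ⟨ u ⟩)) (⊕-isSubspace sX (⊕-isSubspace sC (⟨⟩-isSubspace u))) sDXu X⊕C⊕u⊆)
                        (combine (R3 D (X ⊕ ⟨ u ⟩) sD sXu) (R2 X _ sX (∩-isSubspace sD sXu) X⊆D∩) rXC≤ (ℤP.≤-reflexive r≡))

  r-span-Extends : ∀ {a ℓ} {gs : Vec V a} {T : Vec V ℓ} → Extends gs T → r (span T) ≤ r (span gs) + (+ ℓ - + a)
  r-span-Extends {a} {gs = gs} start = ℤP.≤-reflexive (rearrange (r (span gs)) (+ a))
    where
      rearrange : ∀ x d → x ≡ x + (d - d)
      rearrange = solve-∀
  r-span-Extends {a} {gs = gs} (snoc {ℓ} {T} z ext) =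
    combine {g = r (span gs)} {e = + ℓ} {d = + a} (R2 (span (T ∷ʳ z)) (span T ⊕ ⟨ z ⟩) (span-isSubspace (T ∷ʳ z))
                                  (⊕-isSubspace (span-isSubspace T) (⟨⟩-isSubspace z)) (span-∷ʳ T z))
            (r-⊕⟨⟩≤ (span-isSubspace T) z) (r-span-Extends ext)
    where
      combine : ∀ {s t u g e d} → s ≤ t → t ≤ u + + 1 → u ≤ g + (e - d) → s ≤ g + ((+ 1 + e) - d)
      combine {s} {t} {u} {g} {e} {d} h₁ h₂ h₃ = ≤-from-difference (rearrange s t u g e d) (ℤP.+-mono-≤ (ℤP.+-mono-≤ h₁ h₂) h₃)
        where
          rearrange : ∀ s t u g e d → (g + ((+ 1 + e) - d)) - s ≡ ((t + (u + + 1)) + (g + (e - d))) - ((s + t) + u)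
          rearrange = solve-∀

  flat-r< : ∀ {F G} → IsSubspace F → IsSubspace G → IsFlat G → G ⊆ F → ¬ (F ⊆ G) → r G < r F
  flat-r< {F} {G} sF sG flatG G⊆F F⊈G = decidable-stable (r G ℤ.<? r F) (⊈⇒∃∉ F⊈G >>= λ (v , v∈F , v∉G) →
    let v≢0 : v ≢ 0V
        v≢0 v≡0 = not-¬ (subst (_∈S G) (sym v≡0) (zero∈ sG)) v∉G
    in pure (ℤP.<-≤-trans (flatG v v≢0 v∉G)
                          (R2 (G ⊕ ⟨ v ⟩) F (⊕-isSubspace sG (⟨⟩-isSubspace v)) sF (⊕-least sF G⊆F (⟨⟩-least sF v∈F)))))

  cyclic-r-gap : ∀ {F G} → IsSubspace F → IsCyclic F → IsSubspace G → G ⊆ F → ¬ (F ⊆ G) →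
                 ∀ {dF dG} → HasDim F dF → HasDim G dG → r F - r G < + dF - + dG
  cyclic-r-gap {F} {G} sF cycF sG G⊆F F⊈G {dF} {dG} dimF dimG =
    decidable-stable (r F - r G ℤ.<? + dF - + dG)
      (extend-to-basis sF fs fs-spans gs (AllIn-mono G⊆F gs∈) gs-indep >>= λ (_ , _ , ext , T-basis) → pure (gap ext T-basis))
    where
      fs = proj₁ (HasDim⇒Basis dimF)
      fs-spans = proj₂ (proj₂ (proj₂ (HasDim⇒Basis dimF)))
      gs = proj₁ (HasDim⇒Basis dimG)
      gs∈ = proj₁ (proj₂ (HasDim⇒Basis dimG))
      gs-indep = proj₁ (proj₂ (proj₂ (HasDim⇒Basis dimG)))
      gs-spans = proj₂ (proj₂ (proj₂ (HasDim⇒Basis dimG)))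
      r-span-gs : r (span gs) ≡ r G
      r-span-gs = r-mutual-⊆ (span-isSubspace gs) sG (span-least sG gs∈) gs-spans
      combine : ∀ {f g e d D} → f ≤ g + (e - d) → + 1 + e ≤ D → f - g < D - d
      combine {f} {g} {e} {d} {D} h₁ h₂ = ℤP.suc[i]≤j⇒i<j (≤-from-difference (rearrange f g e d D) (ℤP.+-mono-≤ h₁ h₂))
        where
          rearrange : ∀ f g e d D → (D - d) - (+ 1 + (f - g)) ≡ ((g + (e - d)) + D) - (f + (+ 1 + e))
          rearrange = solve-∀
      gap : ∀ {ℓ} {T : Vec V ℓ} → Extends gs T → Basis F T → r F - r G < + dF - + dG
      gap start (_ , _ , F⊆span) = contradiction (⊆-trans F⊆span (span-least sG gs∈)) F⊈G
      gap (snoc {ℓ} {H} z ext) H-z-basis@(H-z∈ , H-z-indep , _) = combine {e = + ℓ} {d = + dG}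
        (subst (_≤ r G + (+ ℓ - + dG)) r-span-H≡r-F (subst (λ x → r (span H) ≤ x + (+ ℓ - + dG)) r-span-gs (r-span-Extends ext)))
        (ℤ.+≤+ (steinitz (H ∷ʳ z) fs H-z-indep (AllIn-mono fs-spans H-z∈)))
        where
          span-H-codim1 : Codim1 (span H) F
          span-H-codim1 = ℓ , Basis⇒HasDim (H ∷ʳ z) H-z-basis ,
                          Basis⇒HasDim H (AllIn-span H , independent-init H z H-z-indep , ⊆-refl)
          r-span-H≡r-F : r (span H) ≡ r F
          r-span-H≡r-F = cycF (span H) (span-isSubspace H) (span-least sF (AllIn-init H H-z∈)) span-H-codim1

  module Cyc {X W : Sub} (sX : IsSubspace X) (cycW : IsCyc X W) where

    ∈cyc⁻ : ∀ {v} → v ∈S W → SpanMem (CycGen X) v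
    ∈cyc⁻ {v} = proj₁ (cycW v)

    ∈cyc⁺ : ∀ {v} → SpanMem (CycGen X) v → v ∈S W
    ∈cyc⁺ {v} = proj₂ (cycW v)

    vsum∈ : ∀ {B} → IsSubspace B → (∀ u → CycGen X u → u ∈S B) → ∀ {us} → All (CycGen X) us → vsum us ∈S B
    vsum∈ sB gens∈B [] = zero∈ sB
    vsum∈ sB gens∈B (g ∷ gs) = +∈ sB _ _ (gens∈B _ g) (vsum∈ sB gens∈B gs)

    cyc-least : ∀ {B} → IsSubspace B → (∀ u → CycGen X u → u ∈S B) → W ⊆ B
    cyc-least {B} sB gens∈B v v∈W = let (us , gens , v≡) = ∈cyc⁻ v∈W in subst (_∈S B) (sym v≡) (vsum∈ sB gens∈B gens)

    CycGen⇒∈cyc : ∀ {u} → CycGen X u → u ∈S W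
    CycGen⇒∈cyc {u} g = ∈cyc⁺ (u L.∷ L.[] , g ∷ [] , sym (⊞-identityʳ u))

    cyc⊆ : W ⊆ X
    cyc⊆ = cyc-least sX (λ u g → proj₁ (proj₂ g))

    CycGen-· : ∀ c {u} → CycGen X u → c · u ≢ 0V → CycGen X (c · u)
    CycGen-· c {u} (u≢0 , u∈X , r≡) cu≢0 = cu≢0 , ·∈ sX c u u∈X , λ B sB B⊆X codim →
      ℤP.≤-antisym
        (ℤP.≤-trans (R2 (B ⊕ ⟨ c · u ⟩) (B ⊕ ⟨ u ⟩) (⊕-isSubspace sB (⟨⟩-isSubspace (c · u))) (⊕-isSubspace sB (⟨⟩-isSubspace u))
                        (⊕-mono {A = B} ⊆-refl (⟨⟩-least (⟨⟩-isSubspace u) (∈⟨⟩⁺ c refl))))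
                    (ℤP.≤-reflexive (r≡ B sB B⊆X codim)))
        (R2 B (B ⊕ ⟨ c · u ⟩) sB (⊕-isSubspace sB (⟨⟩-isSubspace (c · u))) (A⊆A⊕B (⟨⟩-isSubspace (c · u))))

    cyc-isSubspace : IsSubspace W
    cyc-isSubspace = record
      { zero∈ = ∈cyc⁺ (L.[] , [] , refl)
      ; +∈ = λ u v u∈ v∈ → let (us , us-gens , u≡) = ∈cyc⁻ u∈ ; (vs , vs-gens , v≡) = ∈cyc⁻ v∈ in
               ∈cyc⁺ (us L.++ vs , AllP.++⁺ us-gens vs-gens , trans (cong₂ _+V_ u≡ v≡) (sym (vsum-++ us vs)))
      ; ·∈ = λ c v v∈ → let (us , us-gens , v≡) = ∈cyc⁻ v∈ ; (us′ , us′-gens , vsum≡) = scale c us us-gens in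
               ∈cyc⁺ (us′ , us′-gens , trans (cong (c ·_) v≡) (sym vsum≡)) }
      where
        vsum-++ : ∀ (us vs : List V) → vsum (us L.++ vs) ≡ vsum us +V vsum vs
        vsum-++ L.[] vs = sym (⊞-identityˡ _)
        vsum-++ (u L.∷ us) vs = trans (cong (u +V_) (vsum-++ us vs)) (sym (⊞-assoc _ _ _))
        -- Generators scaled to 0 are no longer generators and are dropped.
        scale : ∀ c us → All (CycGen X) us → Σ (List V) λ us′ → All (CycGen X) us′ × vsum us′ ≡ c · vsum us
        scale c L.[] [] = L.[] , [] , sym (⊙-zeroʳ c)
        scale c (u L.∷ us) (g ∷ gs) with scale c us gs | (c · u) ≟V 0V
        ... | us′ , gs′ , vsum≡ | yes cu≡0 = us′ , gs′ ,
              trans vsum≡ (trans (sym (⊞-identityˡ _)) (trans (cong (_+V (c · vsum us)) (sym cu≡0)) (sym (⊙-distribˡ c u _))))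
        ... | us′ , gs′ , vsum≡ | no cu≢0 = (c · u) L.∷ us′ , CycGen-· c g cu≢0 ∷ gs′ ,
              trans (cong ((c · u) +V_) vsum≡) (sym (⊙-distribˡ c u _))

    non-generator-hyperplane : ∀ {y} → y ∈S X → W y ≡ false →
      ¬ ¬ (Σ Sub λ B → IsSubspace B × B ⊆ X × Codim1 B X × r (B ⊕ ⟨ y ⟩) ≢ r B)
    non-generator-hyperplane {y} y∈X y∉W ∄B = not-¬ (CycGen⇒∈cyc (y≢0 , y∈X , r≡)) y∉W
      where
        y≢0 : y ≢ 0V
        y≢0 y≡0 = not-¬ (subst (_∈S W) (sym y≡0) (zero∈ cyc-isSubspace)) y∉W
        r≡ : ∀ B → IsSubspace B → B ⊆ X → Codim1 B X → r (B ⊕ ⟨ y ⟩) ≡ r B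
        r≡ B sB B⊆X codim = decidable-stable (r (B ⊕ ⟨ y ⟩) ℤ.≟ r B) (λ r≢ → ∄B (B , sB , B⊆X , codim , r≢))

    module Separating {B : Sub} (sB : IsSubspace B) (B⊆X : B ⊆ X) (codim : Codim1 B X)
                      {y : V} (y∈X : y ∈S X) (r≢ : r (B ⊕ ⟨ y ⟩) ≢ r B) where

      r-B⊕⟨⟩≡r-X : ∀ {z} → z ∈S X → B z ≡ false → r (B ⊕ ⟨ z ⟩) ≡ r X
      r-B⊕⟨⟩≡r-X {z} z∈X z∉B = r-mutual-⊆ (⊕-isSubspace sB (⟨⟩-isSubspace z)) sX
        (⊕-least sX B⊆X (⟨⟩-least sX z∈X)) (codim1-⊕⟨⟩ sB B⊆X codim z∈X z∉B)

      y∉B : B y ≡ false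
      y∉B = ¬-not λ y∈B → r≢ (r-mutual-⊆ (⊕-isSubspace sB (⟨⟩-isSubspace y)) sB
                                         (⊕-least sB ⊆-refl (⟨⟩-least sB y∈B)) (A⊆A⊕B (⟨⟩-isSubspace y)))

      X⊆B⊕⟨y⟩ : X ⊆ (B ⊕ ⟨ y ⟩)
      X⊆B⊕⟨y⟩ = codim1-⊕⟨⟩ sB B⊆X codim y∈X y∉B

      r-B<r-X : + 1 + r B ≤ r X
      r-B<r-X = ℤP.i<j⇒suc[i]≤j (ℤP.≤∧≢⇒< (R2 B X sB sX B⊆X) (λ r≡ → r≢ (trans (r-B⊕⟨⟩≡r-X y∈X y∉B) (sym r≡))))

      -- A generator u outside B would give r X ≡ r (B ⊕ ⟨ u ⟩) ≡ r B.
      cyc⊆B : W ⊆ B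
      cyc⊆B = cyc-least sB λ u (_ , u∈X , r≡) → decidable-stable (B u Data.Bool.≟ true) λ u∉B →
        r≢ (trans (r-B⊕⟨⟩≡r-X y∈X y∉B) (trans (sym (r-B⊕⟨⟩≡r-X u∈X (¬-not u∉B))) (r≡ B sB B⊆X codim)))

      r-∩<r : ∀ {Y} → IsSubspace Y → y ∈S Y → + 1 + r (Y ∩ B) ≤ r Y
      r-∩<r {Y} sY y∈Y = combine (R3 Y B sY sB) (R2 X (Y ⊕ B) sX (⊕-isSubspace sY sB) X⊆Y⊕B) r-B<r-X
        where
          X⊆Y⊕B : X ⊆ (Y ⊕ B)
          X⊆Y⊕B x x∈X = let (b , t , b∈B , t∈ , x≡) = ∈⊕⁻ B ⟨ y ⟩ (X⊆B⊕⟨y⟩ x x∈X) in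
            ∈⊕⁺ Y B (⟨⟩-least sY y∈Y t t∈) b∈B (trans x≡ (⊞-comm b t))
          combine : ∀ {s i t b x} → s + i ≤ t + b → x ≤ s → + 1 + b ≤ x → + 1 + i ≤ t
          combine {s} {i} {t} {b} {x} h₁ h₂ h₃ = ≤-from-difference (rearrange s i t b x) (ℤP.+-mono-≤ h₁ (ℤP.+-mono-≤ h₂ h₃))
            where
              rearrange : ∀ s i t b x → t - (+ 1 + i) ≡ ((t + b) + (s + x)) - ((s + i) + (x + (+ 1 + b)))
              rearrange = solve-∀

    r-cyc+codim≤r : ∀ {d} → HasDim W d → ∀ e {Y} → IsSubspace Y → W ⊆ Y → Y ⊆ X → HasDim Y e → r W + (+ e - + d) ≤ r Y
    r-cyc+codim≤r {d} dimW = <-rec Bound step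
      where
        Bound : ℕ → Set
        Bound e = ∀ {Y} → IsSubspace Y → W ⊆ Y → Y ⊆ X → HasDim Y e → r W + (+ e - + d) ≤ r Y

        step : ∀ e → (∀ {e′} → e′ ℕ.< e → Bound e′) → Bound e
        step e rec {Y} sY W⊆Y Y⊆X dimY = decidable-stable (_ ℤ.≤? _) (¬¬-excluded-middle >>= λ
          { (yes Y⊆W) → pure (Y⊆W-case Y⊆W)
          ; (no Y⊈W) → ⊈⇒∃∉ Y⊈W >>= λ (y , y∈Y , y∉W) →
              non-generator-hyperplane (Y⊆X y y∈Y) y∉W >>= λ (B , sB , B⊆X , codim , r≢) →
              basis-exists (∩-isSubspace sY sB) bs (⊆-trans (λ v → ∈∩⁻ˡ Y B) Y⊆span) >>= λ (_ , bs′ , basis′) →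
              pure (descend sB B⊆X codim y∈Y r≢ basis′) })
          where
            bs = proj₁ (HasDim⇒Basis dimY)
            Y-basis = proj₂ (HasDim⇒Basis dimY)
            Y⊆span = proj₂ (proj₂ Y-basis)

            Y⊆W-case : Y ⊆ W → r W + (+ e - + d) ≤ r Y
            Y⊆W-case Y⊆W = subst (λ k → r W + (+ k - + d) ≤ r Y) (sym e≡d)
                             (ℤP.≤-reflexive (trans (rearrange (r W) (+ d)) (r-mutual-⊆ cyc-isSubspace sY W⊆Y Y⊆W)))
              where
                ws = HasDim⇒Basis dimW
                e≡d : e ≡ d
                e≡d = ℕP.≤-antisym
                  (steinitz bs (proj₁ ws) (proj₁ (proj₂ Y-basis)) (AllIn-mono (⊆-trans Y⊆W (proj₂ (proj₂ (proj₂ ws)))) (proj₁ Y-basis)))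
                  (steinitz (proj₁ ws) bs (proj₁ (proj₂ (proj₂ ws))) (AllIn-mono (⊆-trans W⊆Y Y⊆span) (proj₁ (proj₂ ws))))
                rearrange : ∀ w k → w + (k - k) ≡ w
                rearrange = solve-∀

            descend : ∀ {B} → IsSubspace B → B ⊆ X → Codim1 B X → ∀ {y} → y ∈S Y → r (B ⊕ ⟨ y ⟩) ≢ r B →
                      ∀ {e′} {bs′ : Vec V e′} → Basis (Y ∩ B) bs′ → r W + (+ e - + d) ≤ r Y
            descend {B} sB B⊆X codim {y} y∈Y r≢ {e′} {bs′} basis′ =
              subst (λ k → r W + (+ k - + d) ≤ r Y) (sym e≡1+e′) (combine {w = r W} {k = + e′} {d = + d} IH (r-∩<r sY y∈Y))
              where
                open Separating sB B⊆X codim (Y⊆X y y∈Y) r≢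
                e≡1+e′ : e ≡ suc e′
                e≡1+e′ = dim-∩-hyperplane sY sB (⊆-trans Y⊆X X⊆B⊕⟨y⟩) y∈Y y∉B Y-basis basis′
                IH : r W + (+ e′ - + d) ≤ r (Y ∩ B)
                IH = rec (subst (e′ ℕ.<_) (sym e≡1+e′) ℕP.≤-refl) (∩-isSubspace sY sB)
                       (λ v v∈ → ∈∩⁺ Y B (W⊆Y v v∈) (cyc⊆B v v∈)) (⊆-trans (λ v → ∈∩⁻ˡ Y B) Y⊆X) (Basis⇒HasDim bs′ basis′)
                combine : ∀ {w k d i t} → w + (k - d) ≤ i → + 1 + i ≤ t → w + ((+ 1 + k) - d) ≤ t
                combine {w} {k} {d} {i} {t} h₁ h₂ = ≤-from-difference (rearrange w k d i t) (ℤP.+-mono-≤ h₁ h₂)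
                  where
                    rearrange : ∀ w k d i t → t - (w + ((+ 1 + k) - d)) ≡ (i + t) - ((w + (k - d)) + (+ 1 + i))
                    rearrange = solve-∀

  r-cl⊕+r-cyc∩≤ : ∀ {F G W} → IsSubspace F → IsSubspace G → IsCyc (F ∩ G) W →
                  ∀ {d₁ d₂} → HasDim (F ∩ G) d₁ → HasDim W d₂ → r (cl (F ⊕ G)) + r W + (+ d₁ - + d₂) ≤ r F + r G
  r-cl⊕+r-cyc∩≤ {F} {G} {W} sF sG cycW {d₁} {d₂} dim∩ dimW = begin
    r (cl (F ⊕ G)) + r W + (+ d₁ - + d₂)     ≡⟨ ℤP.+-assoc (r (cl (F ⊕ G))) (r W) _ ⟩
    r (cl (F ⊕ G)) + (r W + (+ d₁ - + d₂))   ≤⟨ ℤP.+-mono-≤ (r-cl≤ (⊕-isSubspace sF sG))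
                                                   (r-cyc+codim≤r dimW d₁ s∩ cyc⊆ ⊆-refl dim∩) ⟩
    r (F ⊕ G) + r (F ∩ G)                    ≤⟨ R3 F G sF sG ⟩
    r F + r G                                ∎
    where
      open ℤP.≤-Reasoning
      s∩ = ∩-isSubspace sF sG
      open Cyc s∩ cycW

theorem3p2 : (𝔽 : FiniteField) (n : ℕ) (M : QMatroid 𝔽 n) →
    let open Space 𝔽 n
        open QMatroid M
        open QM M
    in
    -- (Z1)  r(0_Z) = 0,  where 0_Z = cl(⟨0⟩)
    (r (cl ⟨0⟩) ≡ + 0)
    -- (Z2)  G < F in Z  ⇒  0 < r(F) - r(G) < dim F - dim G
    × (∀ F G → IsCyclicFlat F → IsCyclicFlat G → G ⊆ F → ¬ (F ⊆ G) →
         ∀ dF dG → HasDim F dF → HasDim G dG →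
         (+ 0 < r F - r G) × (r F - r G < + dF - + dG))
    -- (Z3)  r(F) + r(G) ≥ r(F ∨ G) + r(F ∧ G) + dim((F ∩ G)/(F ∧ G)),
    --       F ∨ G = cl(F + G),  F ∧ G = W = cyc(F ∩ G)
    × (∀ F G → IsCyclicFlat F → IsCyclicFlat G →
         ∀ W → IsCyc (F ∩ G) W →
         ∀ d₁ d₂ → HasDim (F ∩ G) d₁ → HasDim W d₂ →
         r (cl (F ⊕ G)) + r W + (+ d₁ - + d₂) ≤ r F + r G)
theorem3p2 𝔽 n M =
    r-cl⟨0⟩≡0
  , (λ F G (sF , _ , cycF) (sG , flatG , _) G⊆F F⊈G dF dG dimF dimG →
       i<j⇒0<j-i (flat-r< sF sG flatG G⊆F F⊈G) , cyclic-r-gap sF cycF sG G⊆F F⊈G dimF dimG)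
  , (λ F G (sF , _) (sG , _) W cycW d₁ d₂ dim∩ dimW → r-cl⊕+r-cyc∩≤ sF sG cycW dim∩ dimW)
  where open Rank M
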